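{- For every integer $n\ge 2$, \[\mathcal{I}_n(n)=3\,\mathcal{I}_{n-1}(n-1)+3^{n-1}-2\,\mathcal{D}_{n-1}(n-1,n-1).\]
   Context: For positive integers $m,n$, let $T_{m,n}$ be the table with $m$ rows and $n$ columns; cell $(x,y)$ is in column $x$ and row $y$ (rows numbered from the bottom). Allowed steps are $(1,0),(1,1),(1,-1)$. A perfect lattice path in $T_{m,n}$ is a sequence of rows $(r_1,\dots,r_n)$ with $r_i\in\{1,\dots,m\}$ and $|r_{i+1}-r_i|\le1$ (a path from the first column to the last column staying in the table); $\mathcal{I}_m(n)$ is the number of them. For $1\le s\le k$ and $1\le t\le k$, $\mathcal{D}_k(s,t)$ denotes the number of sequences $(r_1,\dots,r_s)$ with $r_i\in\{1,\dots,k\}$, $|r_{i+1}-r_i|\le1$ and $r_s=t$, i.e. the number of such paths inside the square $k\times k$ table from any cell of the first column to the $(s,t)$-cell. -}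

module Defs where

open import Data.Nat using (ℕ; zero; suc; _≤_; _≤?_; _≡ᵇ_)
open import Data.Nat.Properties using (_≟_)
open import Data.List using (List; []; _∷_; length; filter; map; concatMap; upTo; last)

open import Data.Product using (_×_)
open import Data.Unit using (⊤)
open import Data.Empty using (⊥)
open import Relation.Nullary using (Dec; yes; no; _×-dec_)
open import Relation.Binary.PropositionalEquality using (_≡_)

seqs : ℕ → ℕ → List (List ℕ)
seqs m zero = [] ∷ []
seqs m (suc l) = concatMap (λ r → map (r ∷_) (seqs m l)) (map suc (upTo m))

dist : ℕ → ℕ → ℕ
dist zero b = b
dist (suc a) zero = suc a
dist (suc a) (suc b) = dist a b

Adjacent : List ℕ → Set
Adjacent [] = ⊤
Adjacent (x ∷ []) = ⊤
Adjacent (x ∷ y ∷ rs) = (dist x y ≤ 1) × Adjacent (y ∷ rs)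

adjacent? : (rs : List ℕ) → Dec (Adjacent rs)
adjacent? [] = yes _
adjacent? (x ∷ []) = yes _
adjacent? (x ∷ y ∷ rs) = (dist x y ≤? 1) ×-dec adjacent? (y ∷ rs)

-- last entry equals t (lists here are nonempty; default 0 never matches t ≥ 1)
lastOr0 : List ℕ → ℕ
lastOr0 [] = 0
lastOr0 (x ∷ []) = x
lastOr0 (x ∷ y ∷ rs) = lastOr0 (y ∷ rs)

endsAt? : (t : ℕ) (rs : List ℕ) → Dec (lastOr0 rs ≡ t)
endsAt? t rs = lastOr0 rs ≟ t

-- 𝓘_m(n): number of perfect lattice paths in T_{m,n}
I : ℕ → ℕ → ℕ
I m n = length (filter adjacent? (seqs m n))

D : ℕ → ℕ → ℕ → ℕ
D k s t = length (filter (λ rs → adjacent? rs ×-dec endsAt? t rs) (seqs k s))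

-- Write P_m(l, r) for the number of walks of l steps in rows 1..m starting at row r, and
-- S_m(l) = Σ_r P_m(l, r), so that 𝓘_m(l+1) = S_m(l).  A walk can be preceded by a step from
-- three rows unless it starts in row 1 or row m, and the reflection r ↦ m+1-r makes these two
-- losses equal: S_m(l+1) + 2 P_m(l, m) = 3 S_m(l).  A walk of l < m steps from the top row of
-- an (m+1)-row table never meets its bottom row, so P_{m+1}(l, m+1) = P_m(l, m); subtracting the
-- identity for m from the one for m+1 gives S_{m+1}(l) = S_m(l) + 3^l for l ≤ m.  Finally
-- 𝓓_m(l+1, t) = P_m(l, t), because the transfer matrix of one step is symmetric.

module Submission where

open import Defs
open import Data.Nat using (ℕ; zero; suc; _≤_; _<_; _+_; _*_; _∸_; _^_; _≤ᵇ_; _<ᵇ_; _≡ᵇ_; z≤n; s≤s; z<s)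
open import Data.Nat.Properties
open import Algebra.Properties.Semiring.Sum +-*-semiring
  using (sum-syntax; sum-cong-≗; ∑-distrib-+; ∑-comm; *-distribˡ-sum; *-distribʳ-sum; sum-init-last; sum-replicate-zero)
open import Data.Bool using (Bool; true; false; if_then_else_; _∧_)
open import Data.Bool.Properties using (∧-assoc; ∧-identityʳ; T-≡)
open import Data.Fin using (toℕ)
open import Data.Fin.Properties using (toℕ<n; toℕ-fromℕ; toℕ-inject₁)
open import Data.List using (List; []; _∷_; length; filter; map; concatMap; applyUpTo; upTo; _++_)
open import Data.List.Properties using (concatMap-map)
open import Data.Nat.GeneralisedArithmetic using (fold)
open import Function using (_∘_; Equivalence)
open import Relation.Nullary using (Dec; does)
open import Relation.Binary.PropositionalEquality using (_≡_; refl; sym; trans; cong; cong₂; subst; module ≡-Reasoning)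
open import Data.Nat.Tactic.RingSolver using (solve-∀)
open ≡-Reasoning

Σ< : ℕ → (ℕ → ℕ) → ℕ
Σ< n f = ∑[ i < n ] f (toℕ i)

Σ<-cong : ∀ n {f g : ℕ → ℕ} → (∀ i → i < n → f i ≡ g i) → Σ< n f ≡ Σ< n g
Σ<-cong n f≗g = sum-cong-≗ {n} (λ i → f≗g (toℕ i) (toℕ<n i))

Σ<-distrib-+ : ∀ n (f g : ℕ → ℕ) → Σ< n (λ i → f i + g i) ≡ Σ< n f + Σ< n g
Σ<-distrib-+ n f g = ∑-distrib-+ {n} (f ∘ toℕ) (g ∘ toℕ)

Σ<-comm : ∀ m n (f : ℕ → ℕ → ℕ) → Σ< m (λ i → Σ< n (f i)) ≡ Σ< n (λ j → Σ< m (λ i → f i j))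
Σ<-comm m n f = ∑-comm {m} {n} (λ i j → f (toℕ i) (toℕ j))

*-distribˡ-Σ< : ∀ n x (f : ℕ → ℕ) → x * Σ< n f ≡ Σ< n (λ i → x * f i)
*-distribˡ-Σ< n x f = *-distribˡ-sum {n} x (f ∘ toℕ)

*-distribʳ-Σ< : ∀ n x (f : ℕ → ℕ) → Σ< n f * x ≡ Σ< n (λ i → f i * x)
*-distribʳ-Σ< n x f = *-distribʳ-sum {n} x (f ∘ toℕ)

Σ<-suc : ∀ n (f : ℕ → ℕ) → Σ< (suc n) f ≡ Σ< n f + f n
Σ<-suc n f = trans (sum-init-last {n} (f ∘ toℕ))
  (cong₂ _+_ (sum-cong-≗ {n} (cong f ∘ toℕ-inject₁)) (cong f (toℕ-fromℕ n)))

Σ<-zero : ∀ n → Σ< n (λ _ → 0) ≡ 0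
Σ<-zero n = sum-replicate-zero n

Σ<-one : ∀ n → Σ< n (λ _ → 1) ≡ n
Σ<-one zero = refl
Σ<-one (suc n) = cong suc (Σ<-one n)

indicator : Bool → ℕ
indicator b = if b then 1 else 0

Σ<-indicator-≡ᵇ : ∀ n (f : ℕ → ℕ) c → c < n → Σ< n (λ i → indicator (i ≡ᵇ c) * f i) ≡ f c
Σ<-indicator-≡ᵇ (suc n) f zero _ = begin
  f 0 + 0 + Σ< n (λ _ → 0) ≡⟨ cong (f 0 + 0 +_) (Σ<-zero n) ⟩
  f 0 + 0 + 0              ≡⟨ cong (_+ 0) (+-identityʳ (f 0)) ⟩
  f 0 + 0                  ≡⟨ +-identityʳ (f 0) ⟩
  f 0                      ∎
Σ<-indicator-≡ᵇ (suc n) f (suc c) (s≤s c<n) = Σ<-indicator-≡ᵇ n (f ∘ suc) c c<n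

count : {A : Set} → (A → Bool) → List A → ℕ
count p [] = 0
count p (x ∷ xs) = indicator (p x) + count p xs

length-filter≡count : {A : Set} {P : A → Set} (P? : ∀ x → Dec (P x)) (xs : List A) →
  length (filter P? xs) ≡ count (does ∘ P?) xs
length-filter≡count P? [] = refl
length-filter≡count P? (x ∷ xs) with does (P? x)
... | true  = cong suc (length-filter≡count P? xs)
... | false = length-filter≡count P? xs

count-cong : {A : Set} {p q : A → Bool} → (∀ x → p x ≡ q x) → ∀ xs → count p xs ≡ count q xs
count-cong p≗q [] = refl
count-cong p≗q (x ∷ xs) = cong₂ _+_ (cong indicator (p≗q x)) (count-cong p≗q xs)

count-++ : {A : Set} (p : A → Bool) (xs ys : List A) → count p (xs ++ ys) ≡ count p xs + count p ys
count-++ p [] ys = refl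
count-++ p (x ∷ xs) ys = trans (cong (indicator (p x) +_) (count-++ p xs ys)) (sym (+-assoc (indicator (p x)) _ _))

count-map : {A B : Set} (p : B → Bool) (f : A → B) (xs : List A) → count p (map f xs) ≡ count (p ∘ f) xs
count-map p f [] = refl
count-map p f (x ∷ xs) = cong (indicator (p (f x)) +_) (count-map p f xs)

count-∧ : {A : Set} (b : Bool) (p : A → Bool) (xs : List A) → count (λ x → b ∧ p x) xs ≡ indicator b * count p xs
count-∧ true p xs = sym (+-identityʳ (count p xs))
count-∧ false p [] = refl
count-∧ false p (x ∷ xs) = count-∧ false p xs

count-concatMap-applyUpTo : {B : Set} (p : B → Bool) (g : ℕ → List B) (f : ℕ → ℕ) (n : ℕ) →
  count p (concatMap g (applyUpTo f n)) ≡ Σ< n (λ i → count p (g (f i)))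
count-concatMap-applyUpTo p g f zero = refl
count-concatMap-applyUpTo p g f (suc n) = trans (count-++ p (g (f 0)) _)
  (cong (count p (g (f 0)) +_) (count-concatMap-applyUpTo p g (f ∘ suc) n))

count-seqs-suc : ∀ m l (p : List ℕ → Bool) →
  count p (seqs m (suc l)) ≡ Σ< m (λ i → count (λ s → p (suc i ∷ s)) (seqs m l))
count-seqs-suc m l p = begin
  count p (concatMap cons (map suc (upTo m)))      ≡⟨ cong (count p) (concatMap-map cons suc (upTo m)) ⟩
  count p (concatMap (cons ∘ suc) (upTo m))        ≡⟨ count-concatMap-applyUpTo p (cons ∘ suc) (λ i → i) m ⟩
  Σ< m (λ i → count p (cons (suc i)))              ≡⟨ Σ<-cong m (λ i _ → count-map p (suc i ∷_) (seqs m l)) ⟩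
  Σ< m (λ i → count (λ s → p (suc i ∷ s)) (seqs m l)) ∎
  where
  cons : ℕ → List (List ℕ)
  cons r = map (r ∷_) (seqs m l)

dist-sym : ∀ a b → dist a b ≡ dist b a
dist-sym zero zero = refl
dist-sym zero (suc b) = refl
dist-sym (suc a) zero = refl
dist-sym (suc a) (suc b) = dist-sym a b

adj : ℕ → ℕ → ℕ
adj r y = indicator (dist r y ≤ᵇ 1)

adj-sym : ∀ r y → adj r y ≡ adj y r
adj-sym r y = cong (λ d → indicator (d ≤ᵇ 1)) (dist-sym r y)

transfer : ℕ → (ℕ → ℕ) → ℕ → ℕ
transfer m g r = Σ< m (λ i → adj r (suc i) * g (suc i))

inner : ℕ → (ℕ → ℕ) → (ℕ → ℕ) → ℕ
inner m f g = Σ< m (λ i → f (suc i) * g (suc i))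

transfer-selfAdjoint : ∀ m (f g : ℕ → ℕ) → inner m f (transfer m g) ≡ inner m (transfer m f) g
transfer-selfAdjoint m f g = begin
  Σ< m (λ i → f (suc i) * Σ< m (λ j → adj (suc i) (suc j) * g (suc j)))
    ≡⟨ Σ<-cong m (λ i _ → *-distribˡ-Σ< m (f (suc i)) (λ j → adj (suc i) (suc j) * g (suc j))) ⟩
  Σ< m (λ i → Σ< m (λ j → f (suc i) * (adj (suc i) (suc j) * g (suc j))))
    ≡⟨ Σ<-comm m m (λ i j → f (suc i) * (adj (suc i) (suc j) * g (suc j))) ⟩
  Σ< m (λ j → Σ< m (λ i → f (suc i) * (adj (suc i) (suc j) * g (suc j))))
    ≡⟨ Σ<-cong m (λ j _ → Σ<-cong m (λ i _ → regroup (f (suc i)) (adj-sym (suc i) (suc j)) (g (suc j)))) ⟩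
  Σ< m (λ j → Σ< m (λ i → adj (suc j) (suc i) * f (suc i) * g (suc j)))
    ≡⟨ Σ<-cong m (λ j _ → sym (*-distribʳ-Σ< m (g (suc j)) (λ i → adj (suc j) (suc i) * f (suc i)))) ⟩
  Σ< m (λ j → Σ< m (λ i → adj (suc j) (suc i) * f (suc i)) * g (suc j)) ∎
  where
  regroup : ∀ x {a b} → a ≡ b → ∀ y → x * (a * y) ≡ b * x * y
  regroup x {a} refl y = trans (sym (*-assoc x a y)) (cong (_* y) (*-comm x a))

fold-step : {A : Set} (z : A) (s : A → A) (l : ℕ) → fold (s z) s l ≡ s (fold z s l)
fold-step z s zero = refl
fold-step z s (suc l) = cong s (fold-step z s l)

fold-transfer-selfAdjoint : ∀ m l (f g : ℕ → ℕ) →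
  inner m f (fold g (transfer m) l) ≡ inner m (fold f (transfer m) l) g
fold-transfer-selfAdjoint m zero f g = refl
fold-transfer-selfAdjoint m (suc l) f g = begin
  inner m f (transfer m (fold g (transfer m) l))   ≡⟨ transfer-selfAdjoint m f (fold g (transfer m) l) ⟩
  inner m (transfer m f) (fold g (transfer m) l)   ≡⟨ fold-transfer-selfAdjoint m l (transfer m f) g ⟩
  inner m (fold (transfer m f) (transfer m) l) g   ≡⟨ cong (λ h → inner m h g) (fold-step f (transfer m) l) ⟩
  inner m (fold f (transfer m) (suc l)) g          ∎

walks : ℕ → ℕ → ℕ → ℕ
walks m l = fold (λ _ → 1) (transfer m) l

count-walks-from : ∀ m l r (e : ℕ → Bool) →
  count (λ s → does (adjacent? (r ∷ s)) ∧ e (lastOr0 (r ∷ s))) (seqs m l) ≡ fold (indicator ∘ e) (transfer m) l r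
count-walks-from m zero r e = +-identityʳ (indicator (e r))
count-walks-from m (suc l) r e = begin
  count p (seqs m (suc l))                                 ≡⟨ count-seqs-suc m l p ⟩
  Σ< m (λ i → count (λ s → p (suc i ∷ s)) (seqs m l))      ≡⟨ Σ<-cong m (λ i _ → step (suc i)) ⟩
  transfer m (fold (indicator ∘ e) (transfer m) l) r       ∎
  where
  p : List ℕ → Bool
  p s = does (adjacent? (r ∷ s)) ∧ e (lastOr0 (r ∷ s))
  q : ℕ → List ℕ → Bool
  q y s = does (adjacent? (y ∷ s)) ∧ e (lastOr0 (y ∷ s))
  step : ∀ y → count (λ s → p (y ∷ s)) (seqs m l) ≡ adj r y * fold (indicator ∘ e) (transfer m) l y
  step y = begin
    count (λ s → p (y ∷ s)) (seqs m l)               ≡⟨ count-cong (λ s → ∧-assoc (dist r y ≤ᵇ 1) _ _) (seqs m l) ⟩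
    count (λ s → (dist r y ≤ᵇ 1) ∧ q y s) (seqs m l) ≡⟨ count-∧ (dist r y ≤ᵇ 1) (q y) (seqs m l) ⟩
    adj r y * count (q y) (seqs m l)                 ≡⟨ cong (adj r y *_) (count-walks-from m l y e) ⟩
    adj r y * fold (indicator ∘ e) (transfer m) l y  ∎

I-suc : ∀ m l → I m (suc l) ≡ Σ< m (λ i → walks m l (suc i))
I-suc m l = begin
  I m (suc l)
    ≡⟨ length-filter≡count adjacent? (seqs m (suc l)) ⟩
  count (does ∘ adjacent?) (seqs m (suc l))
    ≡⟨ count-seqs-suc m l (does ∘ adjacent?) ⟩
  Σ< m (λ i → count (λ s → does (adjacent? (suc i ∷ s))) (seqs m l))
    ≡⟨ Σ<-cong m (λ i _ → count-cong (λ s → sym (∧-identityʳ (does (adjacent? (suc i ∷ s))))) (seqs m l)) ⟩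
  Σ< m (λ i → count (λ s → does (adjacent? (suc i ∷ s)) ∧ true) (seqs m l))
    ≡⟨ Σ<-cong m (λ i _ → count-walks-from m l (suc i) (λ _ → true)) ⟩
  Σ< m (λ i → walks m l (suc i)) ∎

-- D counts walks by their last row; self-adjointness of transfer turns this into a count by the first row.
D-suc : ∀ m l b → b < m → D m (suc l) (suc b) ≡ walks m l (suc b)
D-suc m l b b<m = begin
  D m (suc l) t
    ≡⟨ length-filter≡count _ (seqs m (suc l)) ⟩
  count (λ s → does (adjacent? s) ∧ ends s) (seqs m (suc l))
    ≡⟨ count-seqs-suc m l _ ⟩
  Σ< m (λ i → count (λ s → does (adjacent? (suc i ∷ s)) ∧ ends (suc i ∷ s)) (seqs m l))
    ≡⟨ Σ<-cong m (λ i _ → count-walks-from m l (suc i) (_≡ᵇ t)) ⟩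
  Σ< m (λ i → walksTo (suc i))
    ≡⟨ Σ<-cong m (λ i _ → sym (*-identityʳ (walksTo (suc i)))) ⟩
  inner m walksTo (λ _ → 1)
    ≡⟨ sym (fold-transfer-selfAdjoint m l δ (λ _ → 1)) ⟩
  inner m δ (walks m l)
    ≡⟨ Σ<-indicator-≡ᵇ m (walks m l ∘ suc) b b<m ⟩
  walks m l t ∎
  where
  t = suc b
  ends : List ℕ → Bool
  ends s = lastOr0 s ≡ᵇ t
  δ : ℕ → ℕ
  δ = indicator ∘ (_≡ᵇ t)
  walksTo : ℕ → ℕ
  walksTo = fold δ (transfer m) l

Σ<-adj-zero : ∀ n (k : ℕ → ℕ) → k (suc n) ≡ 0 → Σ< (suc n) (λ i → adj 0 i * k i) ≡ k 0 + k 1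
Σ<-adj-zero zero k k1≡0 = begin
  k 0 + 0 + 0 ≡⟨ +-identityʳ (k 0 + 0) ⟩
  k 0 + 0     ≡⟨ cong (k 0 +_) (sym k1≡0) ⟩
  k 0 + k 1   ∎
Σ<-adj-zero (suc n) k _ = begin
  k 0 + 0 + (k 1 + 0 + Σ< n (λ _ → 0)) ≡⟨ cong₂ _+_ (+-identityʳ (k 0)) (cong (k 1 + 0 +_) (Σ<-zero n)) ⟩
  k 0 + (k 1 + 0 + 0)                  ≡⟨ cong (k 0 +_) (trans (+-identityʳ (k 1 + 0)) (+-identityʳ (k 1))) ⟩
  k 0 + k 1                            ∎

Σ<-adj-suc : ∀ n (h : ℕ → ℕ) c → suc c < n → h n ≡ 0 →
  Σ< n (λ i → adj (suc c) i * h i) ≡ h c + h (suc c) + h (suc (suc c))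
Σ<-adj-suc (suc (suc n)) h zero _ hn≡0 = begin
  h 0 + 0 + Σ< (suc n) (λ i → adj 0 i * h (suc i)) ≡⟨ cong₂ _+_ (+-identityʳ (h 0)) (Σ<-adj-zero n (h ∘ suc) hn≡0) ⟩
  h 0 + (h 1 + h 2)                                ≡⟨ +-assoc (h 0) (h 1) (h 2) ⟨
  h 0 + h 1 + h 2                                  ∎
Σ<-adj-suc (suc n) h (suc c) (s≤s c<n) hn≡0 = Σ<-adj-suc n (h ∘ suc) c c<n hn≡0

transfer-three-term : ∀ m (g : ℕ → ℕ) b → b < m → g 0 ≡ 0 → g (suc m) ≡ 0 →
  transfer m g (suc b) ≡ g b + g (suc b) + g (suc (suc b))
transfer-three-term (suc m) g zero _ g0≡0 gtop≡0 = begin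
  Σ< (suc m) (λ i → adj 0 i * g (suc i)) ≡⟨ Σ<-adj-zero m (g ∘ suc) gtop≡0 ⟩
  g 1 + g 2                              ≡⟨ cong (λ x → x + g 1 + g 2) g0≡0 ⟨
  g 0 + g 1 + g 2                        ∎
transfer-three-term m g (suc c) c<m _ gtop≡0 = Σ<-adj-suc m (g ∘ suc) c c<m gtop≡0

-- Unlike walks, paths vanishes off the table, so the three-term recursion holds at the edges too.
paths : ℕ → ℕ → ℕ → ℕ
paths m l zero = 0
paths m zero (suc b) = indicator (b <ᵇ m)
paths m (suc l) (suc b) = if b <ᵇ m then paths m l b + paths m l (suc b) + paths m l (suc (suc b)) else 0

total : ℕ → ℕ → ℕ
total m l = Σ< m (λ i → paths m l (suc i))

<ᵇ-true : ∀ {b m} → b < m → (b <ᵇ m) ≡ true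
<ᵇ-true b<m = Equivalence.to T-≡ (<⇒<ᵇ b<m)

<ᵇ-irrefl : ∀ m → (m <ᵇ m) ≡ false
<ᵇ-irrefl zero = refl
<ᵇ-irrefl (suc m) = <ᵇ-irrefl m

paths-base : ∀ {m b} → b < m → paths m zero (suc b) ≡ 1
paths-base b<m = cong indicator (<ᵇ-true b<m)

paths-step : ∀ {m b} l → b < m →
  paths m (suc l) (suc b) ≡ paths m l b + paths m l (suc b) + paths m l (suc (suc b))
paths-step {m} {b} l b<m rewrite <ᵇ-true b<m = refl

paths-top : ∀ m l → paths m l (suc m) ≡ 0
paths-top m zero rewrite <ᵇ-irrefl m = refl
paths-top m (suc l) rewrite <ᵇ-irrefl m = refl

walks≡paths : ∀ m l b → b < m → walks m l (suc b) ≡ paths m l (suc b)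
walks≡paths m zero b b<m = sym (paths-base b<m)
walks≡paths m (suc l) b b<m = begin
  transfer m (walks m l) (suc b)
    ≡⟨ Σ<-cong m (λ i i<m → cong (adj (suc b) (suc i) *_) (walks≡paths m l i i<m)) ⟩
  transfer m (paths m l) (suc b)
    ≡⟨ transfer-three-term m (paths m l) b b<m refl (paths-top m l) ⟩
  paths m l b + paths m l (suc b) + paths m l (suc (suc b))
    ≡⟨ paths-step l b<m ⟨
  paths m (suc l) (suc b) ∎

I≡total : ∀ m l → I m (suc l) ≡ total m l
I≡total m l = trans (I-suc m l) (Σ<-cong m (walks≡paths m l))

D≡paths : ∀ m l b → b < m → D m (suc l) (suc b) ≡ paths m l (suc b)
D≡paths m l b b<m = trans (D-suc m l b b<m) (walks≡paths m l b b<m)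

total-suc-boundary : ∀ m l → total m (suc l) + paths m l 1 + paths m l m ≡ 3 * total m l
total-suc-boundary m l = begin
  total m (suc l) + p 1 + p m
    ≡⟨ cong (λ x → x + p 1 + p m) (Σ<-cong m (λ i → paths-step l)) ⟩
  Σ< m (λ i → p i + p (suc i) + p (suc (suc i))) + p 1 + p m
    ≡⟨ cong (λ x → x + p 1 + p m) split ⟩
  Σ< m p + total m l + Σ< m (p ∘ suc ∘ suc) + p 1 + p m
    ≡⟨ regroup (Σ< m p) (total m l) (Σ< m (p ∘ suc ∘ suc)) (p 1) (p m) ⟩
  (Σ< m p + p m) + total m l + (p 1 + Σ< m (p ∘ suc ∘ suc))
    ≡⟨ cong₂ (λ x y → x + total m l + y) (sym (Σ<-suc m p)) above ⟩
  total m l + total m l + total m l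
    ≡⟨ triple (total m l) ⟩
  3 * total m l ∎
  where
  p : ℕ → ℕ
  p = paths m l
  split : Σ< m (λ i → p i + p (suc i) + p (suc (suc i))) ≡ Σ< m p + total m l + Σ< m (p ∘ suc ∘ suc)
  split = trans (Σ<-distrib-+ m (λ i → p i + p (suc i)) (p ∘ suc ∘ suc))
                (cong (_+ Σ< m (p ∘ suc ∘ suc)) (Σ<-distrib-+ m p (p ∘ suc)))
  above : p 1 + Σ< m (p ∘ suc ∘ suc) ≡ total m l
  above = trans (Σ<-suc m (p ∘ suc)) (trans (cong (total m l +_) (paths-top m l)) (+-identityʳ (total m l)))
  regroup : ∀ x t y a b → x + t + y + a + b ≡ (x + b) + t + (a + y)
  regroup = solve-∀
  triple : ∀ t → t + t + t ≡ 3 * t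
  triple = solve-∀

paths-reflect : ∀ m l r r′ → r + r′ ≡ suc m → paths m l r ≡ paths m l r′
paths-reflect m l zero r′ refl = sym (paths-top m l)
paths-reflect m l (suc a) zero eq rewrite +-identityʳ a | suc-injective eq = paths-top m l
paths-reflect m l (suc a) (suc b) eq = go l
  where
  a+1+b≡m : a + suc b ≡ m
  a+1+b≡m = suc-injective eq
  a<m : a < m
  a<m = subst (a <_) a+1+b≡m (m<m+n a z<s)
  b<m : b < m
  b<m = subst (suc b ≤_) a+1+b≡m (m≤n+m (suc b) a)
  go : ∀ l → paths m l (suc a) ≡ paths m l (suc b)
  go zero = trans (paths-base a<m) (sym (paths-base b<m))
  go (suc l) = begin
    paths m (suc l) (suc a)
      ≡⟨ paths-step l a<m ⟩
    paths m l a + paths m l (suc a) + paths m l (suc (suc a))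
      ≡⟨ cong₂ _+_ (cong₂ _+_ (paths-reflect m l a (suc (suc b)) (trans (+-suc a (suc b)) (cong suc a+1+b≡m)))
                             (paths-reflect m l (suc a) (suc b) eq))
                   (paths-reflect m l (suc (suc a)) b (cong suc (trans (sym (+-suc a b)) a+1+b≡m))) ⟩
    paths m l (suc (suc b)) + paths m l (suc b) + paths m l b
      ≡⟨ reverse3 (paths m l (suc (suc b))) (paths m l (suc b)) (paths m l b) ⟩
    paths m l b + paths m l (suc b) + paths m l (suc (suc b))
      ≡⟨ paths-step l b<m ⟨
    paths m (suc l) (suc b) ∎
    where
    reverse3 : ∀ x y z → x + y + z ≡ z + y + x
    reverse3 = solve-∀

paths-shift : ∀ m l c → l < c → paths (suc m) l (suc c) ≡ paths m l c
paths-shift m zero (suc b) _ = refl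
paths-shift m (suc l) (suc b) (s≤s l<b) =
  cong (λ x → if b <ᵇ m then x else 0)
    (cong₂ _+_ (cong₂ _+_ (paths-shift m l b l<b) (paths-shift m l (suc b) (m<n⇒m<1+n l<b)))
               (paths-shift m l (suc (suc b)) (m<n⇒m<1+n (m<n⇒m<1+n l<b))))

total-suc : ∀ m l → total m (suc l) + 2 * paths m l m ≡ 3 * total m l
total-suc m l = begin
  total m (suc l) + 2 * x      ≡⟨ double (total m (suc l)) x ⟩
  total m (suc l) + x + x      ≡⟨ cong (λ y → total m (suc l) + y + x) (paths-reflect m l m 1 (+-comm m 1)) ⟩
  total m (suc l) + paths m l 1 + x ≡⟨ total-suc-boundary m l ⟩
  3 * total m l                ∎
  where
  x = paths m l m
  double : ∀ a b → a + 2 * b ≡ a + b + b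
  double = solve-∀

total-suc-taller : ∀ m l → l < m → total (suc m) (suc l) + 2 * paths m l m ≡ 3 * total (suc m) l
total-suc-taller m l l<m =
  trans (cong (λ x → total (suc m) (suc l) + 2 * x) (sym (paths-shift m l m l<m))) (total-suc (suc m) l)

total-zero : ∀ m → total m zero ≡ m
total-zero m = trans (Σ<-cong m (λ i → paths-base)) (Σ<-one m)

total-grow : ∀ m l → l ≤ m → total (suc m) l ≡ total m l + 3 ^ l
total-grow m zero _ = trans (total-zero (suc m)) (trans (+-comm 1 m) (cong (_+ 1) (sym (total-zero m))))
total-grow m (suc l) l<m = +-cancelʳ-≡ (2 * x) _ _ (begin
  total (suc m) (suc l) + 2 * x       ≡⟨ total-suc-taller m l l<m ⟩
  3 * total (suc m) l                 ≡⟨ cong (3 *_) (total-grow m l (<⇒≤ l<m)) ⟩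
  3 * (total m l + 3 ^ l)             ≡⟨ *-distribˡ-+ 3 (total m l) (3 ^ l) ⟩
  3 * total m l + 3 ^ suc l           ≡⟨ cong (_+ 3 ^ suc l) (total-suc m l) ⟨
  total m (suc l) + 2 * x + 3 ^ suc l ≡⟨ swap (total m (suc l)) (2 * x) (3 ^ suc l) ⟩
  total m (suc l) + 3 ^ suc l + 2 * x ∎)
  where
  x = paths m l m
  swap : ∀ a b c → a + b + c ≡ a + c + b
  swap = solve-∀

theorem2p1 : (n : ℕ) → 2 ≤ n →
    I n n + 2 * D (n ∸ 1) (n ∸ 1) (n ∸ 1) ≡ 3 * I (n ∸ 1) (n ∸ 1) + 3 ^ (n ∸ 1)
theorem2p1 (suc (suc k)) (s≤s (s≤s z≤n)) = begin
  I (suc m) (suc m) + 2 * D m m m         ≡⟨ cong₂ (λ a b → a + 2 * b) (I≡total (suc m) m) (D≡paths m k k ≤-refl) ⟩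
  total (suc m) (suc k) + 2 * paths m k m ≡⟨ total-suc-taller m k ≤-refl ⟩
  3 * total (suc m) k                     ≡⟨ cong (3 *_) (total-grow m k (n≤1+n k)) ⟩
  3 * (total m k + 3 ^ k)                 ≡⟨ *-distribˡ-+ 3 (total m k) (3 ^ k) ⟩
  3 * total m k + 3 ^ m                   ≡⟨ cong (λ a → 3 * a + 3 ^ m) (I≡total m k) ⟨
  3 * I m m + 3 ^ m                       ∎
  where
  m = suc k
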